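{- Let $K$ be a real number field of degree $d$ and let $\beta_1,\dots,\beta_d\in\mathfrak{O}_K^+$ be a basis of $\mathfrak{O}_K$ as a $\mathbb{Z}$-module. If $\alpha\in\mathfrak{O}_K^+$, then $\mathrm{Frob}(\beta_1,\dots,\beta_d,\alpha)=\mathrm{Frob}(\beta_1,\dots,\beta_d)$ if and only if $\alpha\in\mathrm{SG}(\beta_1,\dots,\beta_d)$.
   Context: A real number field is a number field that is a subfield of $\mathbb{R}$; $\mathfrak{O}_K$ is its ring of integers and $\mathfrak{O}_K^+=\mathfrak{O}_K\cap[0,\infty)$. $\mathbb{N}=\{0,1,2,\dots\}$. For any finite list $\gamma_1,\dots,\gamma_k\in\mathfrak{O}_K^+$: $\mathrm{SG}(\gamma_1,\dots,\gamma_k)=\{\sum x_i\gamma_i\mid x_i\in\mathbb{N}\}$; $C_\mathbb{Q}(\gamma_1,\dots,\gamma_k)=\{\sum x_i\gamma_i\mid x_i\in\mathbb{Q}_{\geqslant0}\}$; $\mathrm{Frob}(\gamma_1,\dots,\gamma_k)=\{w\in\mathrm{SG}(\gamma_1,\dots,\gamma_k)\mid w+(C_\mathbb{Q}(\gamma_1,\dots,\gamma_k)\cap\mathfrak{O}_K)\subseteq \mathrm{SG}(\gamma_1,\dots,\gamma_k)\}$. -}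

module Defs where

open import Level using (0ℓ)
open import Algebra.Bundles using (CommutativeRing)
open import Relation.Binary.Structures using (IsTotalOrder)
open import Relation.Nullary using (¬_)
open import Data.Nat using (ℕ; zero; suc)
open import Data.Integer using (ℤ; +_; -[1+_])
open import Data.Rational using (ℚ; mkℚ; 0ℚ) renaming (_≤_ to _≤ℚ_)
open import Data.Fin using (Fin; zero; suc)
open import Data.Product using (Σ; _×_; ∃)
open import Data.List using (List; foldl)
open import Function.Bundles using (_⇔_)
import Relation.Binary.PropositionalEquality

-- A real number field, presented abstractly as an ordered field (a subfield of ℝ
-- with the order induced from ℝ).  Every ordering of a number field comes from a
-- real embedding, so "ordered field of finite degree over ℚ" is exactly
-- "(isomorphic to) a real number field with its real order".
record OrderedField : Set₁ where
  field
    commRing : CommutativeRing 0ℓ 0ℓ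
  open CommutativeRing commRing public hiding (ring)
  infix 4 _≤_
  field
    _≤_          : Carrier → Carrier → Set
    isTotalOrder : IsTotalOrder _≈_ _≤_
    0≉1          : ¬ (0# ≈ 1#)
    _⁻¹          : Carrier → Carrier
    ⁻¹-inverse   : ∀ x → ¬ (x ≈ 0#) → x * (x ⁻¹) ≈ 1#
    +-monoʳ-≤    : ∀ {x y} z → x ≤ y → x + z ≤ y + z
    *-nonneg     : ∀ {x y} → 0# ≤ x → 0# ≤ y → 0# ≤ x * y

module _ (K : OrderedField) where
  open OrderedField K using (Carrier; _≈_; _+_; _*_; -_; 0#; 1#; _≤_; _⁻¹)

  fromℕ : ℕ → Carrier
  fromℕ zero    = 0#
  fromℕ (suc n) = 1# + fromℕ n

  fromℤ : ℤ → Carrier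
  fromℤ (+ n)     = fromℕ n
  fromℤ -[1+ n ]  = - fromℕ (suc n)

  fromℚ : ℚ → Carrier
  fromℚ (mkℚ num den-1 _) = fromℤ num * (fromℕ (suc den-1) ⁻¹)

  sumK : ∀ {k} → (Fin k → Carrier) → Carrier
  sumK {zero}  f = 0#
  sumK {suc k} f = f zero + sumK (λ i → f (suc i))

  HasDegree : ℕ → Set
  HasDegree d = Σ (Fin d → Carrier) λ b →
      (∀ (q : Fin d → ℚ) → sumK (λ i → fromℚ (q i) * b i) ≈ 0# → ∀ i → q i Relation.Binary.PropositionalEquality.≡ 0ℚ)
    × (∀ x → ∃ λ (q : Fin d → ℚ) → x ≈ sumK (λ i → fromℚ (q i) * b i))

  -- value at x of the monic polynomial x^n + a_{n-1} x^{n-1} + ... + a_0,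
  -- coefficients listed as [a_{n-1}, ..., a_0]
  evalMonic : List ℤ → Carrier → Carrier
  evalMonic as x = foldl (λ acc a → acc * x + fromℤ a) 1# as

  InO : Carrier → Set
  InO x = ∃ λ (as : List ℤ) → evalMonic as x ≈ 0#

  InO⁺ : Carrier → Set
  InO⁺ x = InO x × (0# ≤ x)

  IsIntegralBasis : ∀ {d} → (Fin d → Carrier) → Set
  IsIntegralBasis {d} β =
      (∀ i → InO (β i))
    × (∀ (c : Fin d → ℤ) → sumK (λ i → fromℤ (c i) * β i) ≈ 0# → ∀ i → c i Relation.Binary.PropositionalEquality.≡ + 0)
    × (∀ x → InO x → ∃ λ (c : Fin d → ℤ) → x ≈ sumK (λ i → fromℤ (c i) * β i))

  SG : ∀ {k} → (Fin k → Carrier) → Carrier → Set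
  SG {k} γ x = ∃ λ (n : Fin k → ℕ) → x ≈ sumK (λ i → fromℕ (n i) * γ i)

  Cℚ : ∀ {k} → (Fin k → Carrier) → Carrier → Set
  Cℚ {k} γ x = ∃ λ (q : Fin k → ℚ) → (∀ i → 0ℚ ≤ℚ q i) × (x ≈ sumK (λ i → fromℚ (q i) * γ i))

  Frob : ∀ {k} → (Fin k → Carrier) → Carrier → Set
  Frob γ w = SG γ w × (∀ v → Cℚ γ v → InO v → SG γ (w + v))

  snoc : ∀ {k} → (Fin k → Carrier) → Carrier → Fin (suc k) → Carrier
  snoc {zero}  f a zero    = a
  snoc {suc k} f a zero    = f zero
  snoc {suc k} f a (suc i) = snoc (λ j → f (suc j)) a i

  SameSet : (Carrier → Set) → (Carrier → Set) → Set
  SameSet A B = ∀ w → A w ⇔ B w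

{-# OPTIONS --safe #-}

-- Since β is a ℤ-basis of 𝔒_K, every v ∈ 𝔒_K has unique integer coordinates in β;
-- if some multiple N·v (N ≥ 1) lies in SG(β), comparing coordinates shows that those
-- of v are non-negative, so v ∈ SG(β).  Clearing denominators, every v ∈ C_ℚ(γ) has a
-- multiple in SG(γ); hence C_ℚ(γ) ∩ 𝔒_K ⊆ SG(γ) whenever SG(γ) = SG(β), and then
-- Frob(γ) = SG(γ).  If α ∈ SG(β) then SG(β,α) = SG(β), so both Frobenius sets equal
-- SG(β).  Conversely 0 ∈ Frob(β) = Frob(β,α) forces C_ℚ(β,α) ∩ 𝔒_K ⊆ SG(β,α), so
-- α ∈ Frob(β,α) = Frob(β) ⊆ SG(β).

module Submission where

open import Defs
open import Data.Nat using (ℕ; zero; suc)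
import Data.Nat as ℕ
import Data.Nat.Properties as ℕ
open import Data.Integer using (ℤ; +_; -[1+_]; _⊖_; ∣_∣)
import Data.Integer as ℤ
import Data.Integer.Properties as ℤ
open import Data.Rational using (ℚ; mkℚ; 0ℚ; nonNegative) renaming (_≤_ to _≤ℚ_)
import Data.Rational as ℚ
open import Data.Fin using (Fin; zero; suc; inject₁)
import Data.Fin as Fin
open import Data.Vec.Functional using (Vector; tail; init; last)
open import Data.Product using (_,_; proj₁; ∃; ∃₂)
open import Data.Sum using (inj₁; inj₂)
open import Data.Empty using (⊥-elim)
open import Relation.Nullary using (¬_)
open import Function.Bundles using (_⇔_; mk⇔; Equivalence)
import Function.Properties.Equivalence as ⇔
open import Algebra.Bundles using (CommutativeRing)
open import Relation.Binary.Structures using (IsTotalOrder)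
open import Relation.Binary.PropositionalEquality using (_≡_; _≗_; cong)
import Relation.Binary.PropositionalEquality as ≡

infixl 5 _∷ʳ_

_∷ʳ_ : ∀ {A : Set} {k} → Vector A k → A → Vector A (suc k)
_∷ʳ_ {k = zero}  xs x zero    = x
_∷ʳ_ {k = suc k} xs x zero    = xs zero
_∷ʳ_ {k = suc k} xs x (suc i) = (tail xs ∷ʳ x) i

init-∷ʳ : ∀ {A : Set} {k} (xs : Vector A k) x → init (xs ∷ʳ x) ≗ xs
init-∷ʳ {k = suc k} xs x zero    = ≡.refl
init-∷ʳ {k = suc k} xs x (suc i) = init-∷ʳ (tail xs) x i

last-∷ʳ : ∀ {A : Set} {k} (xs : Vector A k) x → last (xs ∷ʳ x) ≡ x
last-∷ʳ {k = zero}  xs x = ≡.refl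
last-∷ʳ {k = suc k} xs x = last-∷ʳ (tail xs) x

+[1+m]*i≡+n⇒i≡+∣i∣ : ∀ m i n → + suc m ℤ.* i ≡ + n → i ≡ + ∣ i ∣
+[1+m]*i≡+n⇒i≡+∣i∣ m (+ k)    n _  = ≡.refl
+[1+m]*i≡+n⇒i≡+∣i∣ m -[1+ k ] n ()

module _ (K : OrderedField) where
  open OrderedField K hiding (zero)
  open import Algebra.Properties.Ring (CommutativeRing.ring commRing)
    using (-0#≈0#; -‿involutive; -‿+-comm; -1*x≈-x; -‿distribˡ-*; -‿distribʳ-*; x≈y⇒x∙y⁻¹≈ε)
  open import Algebra.Properties.CommutativeSemigroup +-commutativeSemigroup using (interchange)
  open import Relation.Binary.Reasoning.Setoid setoid
  private module ≤ = IsTotalOrder isTotalOrder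

  ∑ : ∀ {k} → Vector Carrier k → Carrier
  ∑ = sumK K

  ∑-cong : ∀ {k} {f g : Vector Carrier k} → (∀ i → f i ≈ g i) → ∑ f ≈ ∑ g
  ∑-cong {zero}  f≈g = refl
  ∑-cong {suc k} f≈g = +-cong (f≈g zero) (∑-cong (λ i → f≈g (suc i)))

  ∑-zero : ∀ k → ∑ {k} (λ _ → 0#) ≈ 0#
  ∑-zero zero    = refl
  ∑-zero (suc k) = trans (+-identityˡ _) (∑-zero k)

  ∑-distrib-+ : ∀ {k} (f g : Vector Carrier k) → ∑ (λ i → f i + g i) ≈ ∑ f + ∑ g
  ∑-distrib-+ {zero}  f g = sym (+-identityˡ 0#)
  ∑-distrib-+ {suc k} f g = trans (+-congˡ (∑-distrib-+ (tail f) (tail g))) (interchange _ _ _ _)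

  *-distribˡ-∑ : ∀ {k} x (f : Vector Carrier k) → x * ∑ f ≈ ∑ (λ i → x * f i)
  *-distribˡ-∑ {zero}  x f = zeroʳ x
  *-distribˡ-∑ {suc k} x f = trans (distribˡ x _ _) (+-congˡ (*-distribˡ-∑ x (tail f)))

  ∑-init-last : ∀ {k} (f : Vector Carrier (suc k)) → ∑ f ≈ ∑ (init f) + last f
  ∑-init-last {zero}  f = +-comm _ _
  ∑-init-last {suc k} f = trans (+-congˡ (∑-init-last (tail f))) (sym (+-assoc _ _ _))

  fromℕ-homo-+ : ∀ m n → fromℕ K (m ℕ.+ n) ≈ fromℕ K m + fromℕ K n
  fromℕ-homo-+ zero    n = sym (+-identityˡ _)
  fromℕ-homo-+ (suc m) n = trans (+-congˡ (fromℕ-homo-+ m n)) (sym (+-assoc _ _ _))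

  fromℕ-homo-* : ∀ m n → fromℕ K (m ℕ.* n) ≈ fromℕ K m * fromℕ K n
  fromℕ-homo-* zero    n = sym (zeroˡ _)
  fromℕ-homo-* (suc m) n = begin
    fromℕ K (n ℕ.+ m ℕ.* n)                  ≈⟨ fromℕ-homo-+ n (m ℕ.* n) ⟩
    fromℕ K n + fromℕ K (m ℕ.* n)            ≈⟨ +-cong (sym (*-identityˡ _)) (fromℕ-homo-* m n) ⟩
    1# * fromℕ K n + fromℕ K m * fromℕ K n   ≈⟨ distribʳ _ _ _ ⟨
    fromℕ K (suc m) * fromℕ K n              ∎

  -- If 1 ≤ 0 then 0 ≤ -1, hence 0 ≤ (-1)·(-1) = 1.
  0≤1 : 0# ≤ 1#
  0≤1 with ≤.total 0# 1#
  ... | inj₁ 0≤1 = 0≤1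
  ... | inj₂ 1≤0 = ⊥-elim (0≉1 (≤.antisym 0≤1′ 1≤0))
    where
      0≤-1 : 0# ≤ - 1#
      0≤-1 = ≤.trans (≤.reflexive (sym (-‿inverseʳ 1#)))
               (≤.trans (+-monoʳ-≤ (- 1#) 1≤0) (≤.reflexive (+-identityˡ (- 1#))))
      -1*-1≈1 : - 1# * - 1# ≈ 1#
      -1*-1≈1 = trans (-1*x≈-x (- 1#)) (-‿involutive 1#)
      0≤1′ : 0# ≤ 1#
      0≤1′ = ≤.trans (*-nonneg 0≤-1 0≤-1) (≤.reflexive -1*-1≈1)

  1≤1+x : ∀ {x} → 0# ≤ x → 1# ≤ 1# + x
  1≤1+x {x} 0≤x = ≤.trans (≤.reflexive (sym (+-identityˡ 1#)))
                    (≤.trans (+-monoʳ-≤ 1# 0≤x) (≤.reflexive (+-comm x 1#)))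

  0≤fromℕ : ∀ n → 0# ≤ fromℕ K n
  0≤fromℕ zero    = ≤.refl
  0≤fromℕ (suc n) = ≤.trans 0≤1 (1≤1+x (0≤fromℕ n))

  fromℕ-suc≉0 : ∀ n → ¬ fromℕ K (suc n) ≈ 0#
  fromℕ-suc≉0 n eq = 0≉1 (≤.antisym 0≤1 (≤.trans (1≤1+x (0≤fromℕ n)) (≤.reflexive eq)))

  fromℤ-⊖ : ∀ m n → fromℤ K (m ⊖ n) ≈ fromℕ K m - fromℕ K n
  fromℤ-⊖ m       zero    = sym (trans (+-congˡ -0#≈0#) (+-identityʳ _))
  fromℤ-⊖ zero    (suc n) = sym (+-identityˡ _)
  fromℤ-⊖ (suc m) (suc n) = begin
    fromℤ K (suc m ⊖ suc n)                   ≡⟨ cong (fromℤ K) (ℤ.[1+m]⊖[1+n]≡m⊖n m n) ⟩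
    fromℤ K (m ⊖ n)                           ≈⟨ fromℤ-⊖ m n ⟩
    fromℕ K m - fromℕ K n                     ≈⟨ +-identityˡ _ ⟨
    0# + (fromℕ K m - fromℕ K n)              ≈⟨ +-congʳ (-‿inverseʳ 1#) ⟨
    (1# - 1#) + (fromℕ K m - fromℕ K n)       ≈⟨ interchange _ _ _ _ ⟩
    (1# + fromℕ K m) + (- 1# - fromℕ K n)     ≈⟨ +-congˡ (-‿+-comm 1# (fromℕ K n)) ⟩
    fromℕ K (suc m) - fromℕ K (suc n)         ∎

  fromℤ-homo-neg : ∀ i → fromℤ K (ℤ.- i) ≈ - fromℤ K i
  fromℤ-homo-neg (+ zero)  = sym -0#≈0#
  fromℤ-homo-neg (+ suc n) = refl
  fromℤ-homo-neg -[1+ n ]  = sym (-‿involutive _)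

  fromℤ-homo-+ : ∀ i j → fromℤ K (i ℤ.+ j) ≈ fromℤ K i + fromℤ K j
  fromℤ-homo-+ (+ m)    (+ n)    = fromℕ-homo-+ m n
  fromℤ-homo-+ (+ m)    -[1+ n ] = fromℤ-⊖ m (suc n)
  fromℤ-homo-+ -[1+ m ] (+ n)    = trans (fromℤ-⊖ n (suc m)) (+-comm _ _)
  fromℤ-homo-+ -[1+ m ] -[1+ n ] = begin
    - fromℕ K (suc (suc (m ℕ.+ n)))           ≡⟨ cong (λ k → - fromℕ K (suc k)) (ℕ.+-suc m n) ⟨
    - fromℕ K (suc m ℕ.+ suc n)               ≈⟨ -‿cong (fromℕ-homo-+ (suc m) (suc n)) ⟩
    - (fromℕ K (suc m) + fromℕ K (suc n))     ≈⟨ -‿+-comm _ _ ⟨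
    - fromℕ K (suc m) - fromℕ K (suc n)       ∎

  fromℤ-homo-- : ∀ i j → fromℤ K (i ℤ.- j) ≈ fromℤ K i - fromℤ K j
  fromℤ-homo-- i j = trans (fromℤ-homo-+ i (ℤ.- j)) (+-congˡ (fromℤ-homo-neg j))

  fromℤ-+* : ∀ m i → fromℤ K (+ m ℤ.* i) ≈ fromℕ K m * fromℤ K i
  fromℤ-+* m (+ n) = begin
    fromℤ K (+ m ℤ.* + n)        ≡⟨ cong (fromℤ K) (ℤ.pos-* m n) ⟨
    fromℕ K (m ℕ.* n)            ≈⟨ fromℕ-homo-* m n ⟩
    fromℕ K m * fromℕ K n        ∎
  fromℤ-+* m -[1+ n ] = begin
    fromℤ K (+ m ℤ.* -[1+ n ])           ≡⟨ cong (fromℤ K) (ℤ.neg-distribʳ-* (+ m) (+ suc n)) ⟨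
    fromℤ K (ℤ.- (+ m ℤ.* + suc n))      ≈⟨ fromℤ-homo-neg (+ m ℤ.* + suc n) ⟩
    - fromℤ K (+ m ℤ.* + suc n)          ≈⟨ -‿cong (fromℤ-+* m (+ suc n)) ⟩
    - (fromℕ K m * fromℕ K (suc n))      ≈⟨ -‿distribʳ-* _ _ ⟩
    fromℕ K m * - fromℕ K (suc n)        ∎

  ∑-homo-neg : ∀ {k} (f : Vector Carrier k) → ∑ (λ i → - f i) ≈ - ∑ f
  ∑-homo-neg f = begin
    ∑ (λ i → - f i)         ≈⟨ ∑-cong (λ i → -1*x≈-x (f i)) ⟨
    ∑ (λ i → - 1# * f i)    ≈⟨ *-distribˡ-∑ (- 1#) f ⟨
    - 1# * ∑ f              ≈⟨ -1*x≈-x (∑ f) ⟩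
    - ∑ f                   ∎

  ∑-homo-- : ∀ {k} (f g : Vector Carrier k) → ∑ (λ i → f i - g i) ≈ ∑ f - ∑ g
  ∑-homo-- f g = trans (∑-distrib-+ f (λ i → - g i)) (+-congˡ (∑-homo-neg g))

  ℤ-coordinates-unique : ∀ {d} (β : Vector Carrier d) → IsIntegralBasis K β →
    (a b : Vector ℤ d) →
    ∑ (λ i → fromℤ K (a i) * β i) ≈ ∑ (λ i → fromℤ K (b i) * β i) → ∀ i → a i ≡ b i
  ℤ-coordinates-unique β (_ , independent , _) a b same i =
    ℤ.i-j≡0⇒i≡j (a i) (b i) (independent (λ i → a i ℤ.- b i) difference≈0 i)
    where
      difference≈0 : ∑ (λ i → fromℤ K (a i ℤ.- b i) * β i) ≈ 0#
      difference≈0 = begin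
        ∑ (λ i → fromℤ K (a i ℤ.- b i) * β i)
          ≈⟨ ∑-cong (λ i → *-congʳ (fromℤ-homo-- (a i) (b i))) ⟩
        ∑ (λ i → (fromℤ K (a i) - fromℤ K (b i)) * β i)
          ≈⟨ ∑-cong (λ i → trans (distribʳ (β i) _ _) (+-congˡ (sym (-‿distribˡ-* (fromℤ K (b i)) (β i))))) ⟩
        ∑ (λ i → fromℤ K (a i) * β i - fromℤ K (b i) * β i)
          ≈⟨ ∑-homo-- (λ i → fromℤ K (a i) * β i) (λ i → fromℤ K (b i) * β i) ⟩
        ∑ (λ i → fromℤ K (a i) * β i) - ∑ (λ i → fromℤ K (b i) * β i)
          ≈⟨ x≈y⇒x∙y⁻¹≈ε same ⟩
        0#  ∎

  SG-resp-≈ : ∀ {k} (γ : Vector Carrier k) {x y} → x ≈ y → SG K γ x → SG K γ y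
  SG-resp-≈ γ x≈y (n , x≈) = n , trans (sym x≈y) x≈

  SG-0 : ∀ {k} (γ : Vector Carrier k) → SG K γ 0#
  SG-0 {k} γ = (λ _ → 0) , sym (trans (∑-cong (λ i → zeroˡ (γ i))) (∑-zero k))

  SG-+ : ∀ {k} {γ : Vector Carrier k} {x y} → SG K γ x → SG K γ y → SG K γ (x + y)
  SG-+ {γ = γ} (n , x≈) (m , y≈) = (λ i → n i ℕ.+ m i) , (begin
    _ + _
      ≈⟨ +-cong x≈ y≈ ⟩
    ∑ (λ i → fromℕ K (n i) * γ i) + ∑ (λ i → fromℕ K (m i) * γ i)
      ≈⟨ ∑-distrib-+ (λ i → fromℕ K (n i) * γ i) (λ i → fromℕ K (m i) * γ i) ⟨
    ∑ (λ i → fromℕ K (n i) * γ i + fromℕ K (m i) * γ i)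
      ≈⟨ ∑-cong (λ i → distribʳ (γ i) _ _) ⟨
    ∑ (λ i → (fromℕ K (n i) + fromℕ K (m i)) * γ i)
      ≈⟨ ∑-cong (λ i → *-congʳ (fromℕ-homo-+ (n i) (m i))) ⟨
    ∑ (λ i → fromℕ K (n i ℕ.+ m i) * γ i)
      ∎)

  SG-fromℕ* : ∀ {k} {γ : Vector Carrier k} {x} m → SG K γ x → SG K γ (fromℕ K m * x)
  SG-fromℕ* {γ = γ} m (n , x≈) = (λ i → m ℕ.* n i) , (begin
    fromℕ K m * _                                        ≈⟨ *-congˡ x≈ ⟩
    fromℕ K m * ∑ (λ i → fromℕ K (n i) * γ i)        ≈⟨ *-distribˡ-∑ (fromℕ K m) (λ i → fromℕ K (n i) * γ i) ⟩
    ∑ (λ i → fromℕ K m * (fromℕ K (n i) * γ i))      ≈⟨ ∑-cong (λ i → *-assoc (fromℕ K m) (fromℕ K (n i)) (γ i)) ⟨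
    ∑ (λ i → (fromℕ K m * fromℕ K (n i)) * γ i)      ≈⟨ ∑-cong (λ i → *-congʳ (fromℕ-homo-* m (n i))) ⟨
    ∑ (λ i → fromℕ K (m ℕ.* n i) * γ i)              ∎)

  snoc≗∷ʳ : ∀ {k} (f : Vector Carrier k) a → snoc K f a ≗ f ∷ʳ a
  snoc≗∷ʳ {zero}  f a zero    = ≡.refl
  snoc≗∷ʳ {suc k} f a zero    = ≡.refl
  snoc≗∷ʳ {suc k} f a (suc i) = snoc≗∷ʳ (tail f) a i

  ∑-snoc : ∀ {k} (F : Vector Carrier (suc k)) (f : Vector Carrier k) a →
    ∑ (λ i → F i * snoc K f a i) ≈ ∑ (λ j → F (inject₁ j) * f j) + last F * a
  ∑-snoc {k} F f a = begin
    ∑ (λ i → F i * snoc K f a i)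
      ≈⟨ ∑-init-last (λ i → F i * snoc K f a i) ⟩
    ∑ (λ j → F (inject₁ j) * snoc K f a (inject₁ j)) + last F * snoc K f a (Fin.fromℕ k)
      ≈⟨ +-cong (∑-cong (λ j → *-congˡ (reflexive (≡.trans (snoc≗∷ʳ f a _) (init-∷ʳ f a j)))))
                (*-congˡ (reflexive (≡.trans (snoc≗∷ʳ f a _) (last-∷ʳ f a)))) ⟩
    ∑ (λ j → F (inject₁ j) * f j) + last F * a
      ∎

  module _ {d} (β : Vector Carrier d) (α : Carrier) where

    SG-snoc-intro : ∀ {x} → SG K β x → ∀ m → SG K (snoc K β α) (x + fromℕ K m * α)
    SG-snoc-intro {x} (n , x≈) m = n ∷ʳ m , (begin
      x + fromℕ K m * α
        ≈⟨ +-cong x≈ refl ⟩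
      ∑ (λ j → fromℕ K (n j) * β j) + fromℕ K m * α
        ≈⟨ +-cong (∑-cong (λ j → *-congʳ (reflexive (cong (fromℕ K) (init-∷ʳ n m j)))))
                  (*-congʳ (reflexive (cong (fromℕ K) (last-∷ʳ n m)))) ⟨
      ∑ (λ j → fromℕ K ((n ∷ʳ m) (inject₁ j)) * β j) + fromℕ K (last (n ∷ʳ m)) * α
        ≈⟨ ∑-snoc (λ i → fromℕ K ((n ∷ʳ m) i)) β α ⟨
      ∑ (λ i → fromℕ K ((n ∷ʳ m) i) * snoc K β α i)
        ∎)

    SG-snoc-last : SG K (snoc K β α) α
    SG-snoc-last = SG-resp-≈ (snoc K β α) 0+1α≈α (SG-snoc-intro (SG-0 β) 1)
      where
        0+1α≈α : 0# + (1# + 0#) * α ≈ α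
        0+1α≈α = trans (+-identityˡ _) (trans (*-congʳ (+-identityʳ 1#)) (*-identityˡ α))

    SG⊆SG-snoc : ∀ {x} → SG K β x → SG K (snoc K β α) x
    SG⊆SG-snoc {x} x∈SG = SG-resp-≈ (snoc K β α) (trans (+-congˡ (zeroˡ α)) (+-identityʳ x)) (SG-snoc-intro x∈SG 0)

    SG-snoc⊆SG : SG K β α → ∀ {x} → SG K (snoc K β α) x → SG K β x
    SG-snoc⊆SG α∈SG (M , x≈) =
      SG-resp-≈ β (sym (trans x≈ (∑-snoc (λ i → fromℕ K (M i)) β α)))
        (SG-+ ((λ j → M (inject₁ j)) , refl) (SG-fromℕ* (last M) α∈SG))

    SG-snoc≡SG : SG K β α → SameSet K (SG K (snoc K β α)) (SG K β)
    SG-snoc≡SG α∈SG _ = mk⇔ (SG-snoc⊆SG α∈SG) SG⊆SG-snoc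

  fromℚ-numerator : ∀ q → 0ℚ ≤ℚ q → ∃ λ n → fromℕ K (suc (ℚ.denominator-1 q)) * fromℚ K q ≈ fromℕ K n
  fromℚ-numerator (mkℚ (+ n) m _) _ = n , (begin
    fromℕ K (suc m) * (fromℕ K n * fromℕ K (suc m) ⁻¹)   ≈⟨ *-congˡ (*-comm _ _) ⟩
    fromℕ K (suc m) * (fromℕ K (suc m) ⁻¹ * fromℕ K n)   ≈⟨ *-assoc _ _ _ ⟨
    (fromℕ K (suc m) * fromℕ K (suc m) ⁻¹) * fromℕ K n   ≈⟨ *-congʳ (⁻¹-inverse _ (fromℕ-suc≉0 m)) ⟩
    1# * fromℕ K n                                        ≈⟨ *-identityˡ _ ⟩
    fromℕ K n                                             ∎)
  fromℚ-numerator (mkℚ -[1+ n ] m _) 0≤q = ⊥-elim (ℤ.NonNegative.nonNeg (nonNegative 0≤q))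

  fromℕ-*-clears : ∀ a b s {x} → fromℕ K a * x ≈ fromℕ K s → fromℕ K (b ℕ.* a) * x ≈ fromℕ K (b ℕ.* s)
  fromℕ-*-clears a b s {x} ax≈s = begin
    fromℕ K (b ℕ.* a) * x          ≈⟨ *-congʳ (fromℕ-homo-* b a) ⟩
    (fromℕ K b * fromℕ K a) * x    ≈⟨ *-assoc _ _ _ ⟩
    fromℕ K b * (fromℕ K a * x)    ≈⟨ *-congˡ ax≈s ⟩
    fromℕ K b * fromℕ K s          ≈⟨ fromℕ-homo-* b s ⟨
    fromℕ K (b ℕ.* s)              ∎

  common-denominator : ∀ {k} (q : Vector ℚ k) → (∀ i → 0ℚ ≤ℚ q i) →
    ∃₂ λ D (s : Vector ℕ k) → ∀ i → fromℕ K (suc D) * fromℚ K (q i) ≈ fromℕ K (s i)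
  common-denominator {zero}  q _   = 0 , (λ ()) , λ ()
  common-denominator {suc k} q 0≤q
    with common-denominator (tail q) (λ i → 0≤q (suc i)) | fromℚ-numerator (q zero) (0≤q zero)
  ... | D , s , Ds | n , mn = m ℕ.+ D ℕ.* suc m , s′ , clears
    where
      m = ℚ.denominator-1 (q zero)
      s′ : Vector ℕ (suc k)
      s′ zero    = suc D ℕ.* n
      s′ (suc i) = suc m ℕ.* s i
      clears : ∀ i → fromℕ K (suc D ℕ.* suc m) * fromℚ K (q i) ≈ fromℕ K (s′ i)
      clears zero    = fromℕ-*-clears (suc m) (suc D) n mn
      clears (suc i) = trans (*-congʳ (reflexive (cong (fromℕ K) (ℕ.*-comm (suc D) (suc m)))))
                             (fromℕ-*-clears (suc D) (suc m) (s i) (Ds i))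

  Cℚ⇒multiple∈SG : ∀ {k} {γ : Vector Carrier k} {v} → Cℚ K γ v → ∃ λ D → SG K γ (fromℕ K (suc D) * v)
  Cℚ⇒multiple∈SG {γ = γ} {v} (q , 0≤q , v≈) with common-denominator q 0≤q
  ... | D , s , Ds = D , s , (begin
    fromℕ K (suc D) * v                                   ≈⟨ *-congˡ v≈ ⟩
    fromℕ K (suc D) * ∑ (λ i → fromℚ K (q i) * γ i)    ≈⟨ *-distribˡ-∑ (fromℕ K (suc D)) (λ i → fromℚ K (q i) * γ i) ⟩
    ∑ (λ i → fromℕ K (suc D) * (fromℚ K (q i) * γ i))  ≈⟨ ∑-cong (λ i → *-assoc (fromℕ K (suc D)) (fromℚ K (q i)) (γ i)) ⟨
    ∑ (λ i → (fromℕ K (suc D) * fromℚ K (q i)) * γ i)  ≈⟨ ∑-cong (λ i → *-congʳ (Ds i)) ⟩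
    ∑ (λ i → fromℕ K (s i) * γ i)                      ∎)

  SG-cancel-multiple : ∀ {d} (β : Vector Carrier d) → IsIntegralBasis K β →
    ∀ {v} D → InO K v → SG K β (fromℕ K (suc D) * v) → SG K β v
  SG-cancel-multiple β basis@(_ , _ , coordinates) {v} D v∈O (t , Dv≈) with coordinates v v∈O
  ... | c , v≈ =
    (λ i → ∣ c i ∣) , trans v≈ (∑-cong (λ i → *-congʳ (reflexive (cong (fromℤ K) (c≡+∣c∣ i)))))
    where
      scaled : ∑ (λ i → fromℤ K (+ suc D ℤ.* c i) * β i) ≈ ∑ (λ i → fromℤ K (+ t i) * β i)
      scaled = begin
        ∑ (λ i → fromℤ K (+ suc D ℤ.* c i) * β i)
          ≈⟨ ∑-cong (λ i → trans (*-congʳ (fromℤ-+* (suc D) (c i))) (*-assoc (fromℕ K (suc D)) (fromℤ K (c i)) (β i))) ⟩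
        ∑ (λ i → fromℕ K (suc D) * (fromℤ K (c i) * β i))
          ≈⟨ *-distribˡ-∑ (fromℕ K (suc D)) (λ i → fromℤ K (c i) * β i) ⟨
        fromℕ K (suc D) * ∑ (λ i → fromℤ K (c i) * β i)
          ≈⟨ *-congˡ v≈ ⟨
        fromℕ K (suc D) * v
          ≈⟨ Dv≈ ⟩
        ∑ (λ i → fromℤ K (+ t i) * β i)
          ∎
      c≡+∣c∣ : ∀ i → c i ≡ + ∣ c i ∣
      c≡+∣c∣ i = +[1+m]*i≡+n⇒i≡+∣i∣ D (c i) (t i)
                   (ℤ-coordinates-unique β basis (λ i → + suc D ℤ.* c i) (λ i → + t i) scaled i)

  Saturated : ∀ {k} → Vector Carrier k → Set
  Saturated γ = ∀ v → Cℚ K γ v → InO K v → SG K γ v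

  Saturated⇒Frob⇔SG : ∀ {k} (γ : Vector Carrier k) → Saturated γ → ∀ w → Frob K γ w ⇔ SG K γ w
  Saturated⇒Frob⇔SG γ sat w = mk⇔ proj₁ (λ w∈SG → w∈SG , λ v v∈C v∈O → SG-+ w∈SG (sat v v∈C v∈O))

  0∈Frob⇒Saturated : ∀ {k} (γ : Vector Carrier k) → Frob K γ 0# → Saturated γ
  0∈Frob⇒Saturated γ (_ , 0+C⊆SG) v v∈C v∈O = SG-resp-≈ γ (+-identityˡ v) (0+C⊆SG v v∈C v∈O)

  SG≡basis-SG⇒Saturated : ∀ {d k} (β : Vector Carrier d) (γ : Vector Carrier k) →
    IsIntegralBasis K β → SameSet K (SG K γ) (SG K β) → Saturated γ
  SG≡basis-SG⇒Saturated β γ basis same v v∈C v∈O with Cℚ⇒multiple∈SG v∈C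
  ... | D , Dv∈SG = Equivalence.from (same v)
                      (SG-cancel-multiple β basis D v∈O (Equivalence.to (same _) Dv∈SG))

corollary7 : (K : OrderedField) (d : ℕ) → HasDegree K d →
    (β : Fin d → OrderedField.Carrier K) → (∀ i → InO⁺ K (β i)) → IsIntegralBasis K β →
    (α : OrderedField.Carrier K) → InO⁺ K α →
    SameSet K (Frob K (snoc K β α)) (Frob K β) ⇔ SG K β α
corollary7 K d _ β _ basis α _ = mk⇔ sameFrob⇒α∈SG α∈SG⇒sameFrob
  where
    β-saturated : Saturated K β
    β-saturated = SG≡basis-SG⇒Saturated K β β basis (λ _ → ⇔.refl)

    sameFrob⇒α∈SG : SameSet K (Frob K (snoc K β α)) (Frob K β) → SG K β α
    sameFrob⇒α∈SG same = proj₁ (Equivalence.to (same α) α∈Frob)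
      where
        0∈Frob : Frob K (snoc K β α) (OrderedField.0# K)
        0∈Frob = Equivalence.from (same _) (Equivalence.from (Saturated⇒Frob⇔SG K β β-saturated _) (SG-0 K β))
        α∈Frob : Frob K (snoc K β α) α
        α∈Frob = Equivalence.from (Saturated⇒Frob⇔SG K (snoc K β α) (0∈Frob⇒Saturated K (snoc K β α) 0∈Frob) α) (SG-snoc-last K β α)

    α∈SG⇒sameFrob : SG K β α → SameSet K (Frob K (snoc K β α)) (Frob K β)
    α∈SG⇒sameFrob α∈SG w = ⇔.trans (Saturated⇒Frob⇔SG K (snoc K β α) snoc-saturated w)
                             (⇔.trans (SG-snoc≡SG K β α α∈SG w) (⇔.sym (Saturated⇒Frob⇔SG K β β-saturated w)))
      where
        snoc-saturated : Saturated K (snoc K β α)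
        snoc-saturated = SG≡basis-SG⇒Saturated K β (snoc K β α) basis (SG-snoc≡SG K β α α∈SG)
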